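{- Let $X\subseteq\omega$ with $X=\Theta(X)$. For every $\mathcal{L}_\mathrm{Tr}$-sentence $\varphi$: if $\mathrm{PAT}\cup\{\mathrm{Tr}\ulcorner\psi\urcorner:\#\psi\in X\}\vdash^\omega\varphi$, then $\#\varphi\in X$.
   Context: $\mathcal{L}_\mathrm{Tr}$: language of PA (with finitely many primitive recursive function symbols, including syntactic operations $\dot\neg,\dot\vee,\dot\wedge,\dot\forall,\dot\exists,\dot\rightarrow$, $\dot{\mathrm{Tr}}$ (closed term code $t$ $\mapsto$ code of $\mathrm{Tr}(t)$), substitution $y(t/v)$) plus unary $\mathrm{Tr}$; $\mathrm{PAT}$ is PA in $\mathcal{L}_\mathrm{Tr}$ with full induction; $\#\varphi$ code, $\ulcorner\varphi\urcorner$ its numeral; $t$ ranges over codes of closed terms with value $t^\circ$; $\mathrm{Sent}(x)$ represents sentence codes; $\mathrm{Pr}_{\mathrm{PAT}}$ standard provability predicate; $\mathrm{True}_0$ codes of true $\mathcal{L}_\mathbb{N}$-literals. For a set $S$ of sentence codes, $\mathrm{PAT}\cup\{\mathrm{Tr}\ulcorner\psi\urcorner:\#\psi\in S\}\vdash^\omega\varphi$ means $\varphi$ is derivable in first-order logic with the $\omega$-rule from the axioms of $\mathrm{PAT}$ and the sentences $\mathrm{Tr}\ulcorner\psi\urcorner$ for $\#\psi\in S$. $\xi(x,X)$ is the disjunction of: $x\in\mathrm{True}_0$; $\exists y(x=\dot\neg\dot\neg y\wedge y\in X)$; $\exists y,z(x=y\dot\vee z\wedge(y\in X\vee z\in X))$;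 $\exists y,z(x=\dot\neg(y\dot\vee z)\wedge\dot\neg y\in X\wedge\dot\neg z\in X)$; $\exists y,z(x=y\dot\wedge z\wedge y\in X\wedge z\in X)$; $\exists y,z(x=\dot\neg(y\dot\wedge z)\wedge(\dot\neg y\in X\vee\dot\neg z\in X))$; $\exists y,v(x=\dot\forall vy\wedge\forall z(y(z/v)\in X))$; $\exists y,v(x=\dot\neg\dot\forall vy\wedge\exists z(\dot\neg y(z/v)\in X))$; $\exists y,v(x=\dot\exists vy\wedge\exists z(y(z/v)\in X))$; $\exists y,v(x=\dot\neg\dot\exists vy\wedge\forall z(\dot\neg y(z/v)\in X))$; $\exists t(x=\dot{\mathrm{Tr}}(t)\wedge t^\circ\in X)$; $\exists t(x=\dot\neg\dot{\mathrm{Tr}}(t)\wedge(\dot\neg t^\circ\in X\vee\neg\mathrm{Sent}(t^\circ)))$. $\Theta(S)=\{n:\mathbb{N}\vDash\exists y(\xi(y,S)\wedge\mathrm{Pr}_{\mathrm{PAT}}(y\dot\rightarrow\bar n))\}$. -}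

module Defs where

open import Data.Nat using (ℕ; zero; suc; _+_; _*_; _^_; _≡ᵇ_)
open import Data.Bool using (Bool; true; false; not; _∧_; _∨_; if_then_else_)
open import Data.Fin using (Fin; toℕ)
open import Data.Vec using (Vec; []; _∷_)
open import Data.Product using (Σ; _×_; _,_)
open import Data.Sum using (_⊎_)
open import Relation.Binary.PropositionalEquality using (_≡_)
open import Relation.Nullary using (¬_)

-- Signature: the finitely many extra (primitive recursive) function
-- symbols of L_Tr besides 0, S, +, × (e.g. the syntactic operations).
-- Each has an arity and its standard interpretation in ℕ.

record Sig : Set where
  field
    k      : ℕ
    arity  : Fin k → ℕ
    interp : (f : Fin k) → Vec ℕ (arity f) → ℕ

pair : ℕ → ℕ → ℕ
pair a b = 2 ^ a * suc (2 * b)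

¬̇_ : ℕ → ℕ
¬̇ y = pair 2 y

_∨̇_ : ℕ → ℕ → ℕ
y ∨̇ z = pair 3 (pair y z)

_∧̇_ : ℕ → ℕ → ℕ
y ∧̇ z = pair 4 (pair y z)

_→̇_ : ℕ → ℕ → ℕ
y →̇ z = pair 5 (pair y z)

∀̇ : ℕ → ℕ → ℕ
∀̇ v y = pair 6 (pair v y)

∃̇ : ℕ → ℕ → ℕ
∃̇ v y = pair 7 (pair v y)

Ṫr : ℕ → ℕ
Ṫr t = pair 1 t

module Syntax (sig : Sig) where
  open Sig sig

  data Term : Set where
    var   : ℕ → Term
    zer   : Term
    suc'  : Term → Term
    plus  : Term → Term → Term
    times : Term → Term → Term
    app   : (f : Fin k) → Vec Term (arity f) → Term

  infix 7 _≐_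
  infixr 4 _⇒_
  data Formula : Set where
    _≐_  : Term → Term → Formula
    Tr   : Term → Formula
    ¬'   : Formula → Formula
    _∨'_ : Formula → Formula → Formula
    _∧'_ : Formula → Formula → Formula
    _⇒_  : Formula → Formula → Formula
    ∀'   : ℕ → Formula → Formula
    ∃'   : ℕ → Formula → Formula

  num : ℕ → Term
  num zero    = zer
  num (suc n) = suc' (num n)

  mutual
    codeT : Term → ℕ
    codeT (var x)     = pair 0 x
    codeT zer         = pair 1 0
    codeT (suc' t)    = pair 2 (codeT t)
    codeT (plus s t)  = pair 3 (pair (codeT s) (codeT t))
    codeT (times s t) = pair 4 (pair (codeT s) (codeT t))
    codeT (app f ts)  = pair 5 (pair (toℕ f) (codeTs ts))

    codeTs : ∀ {n} → Vec Term n → ℕ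
    codeTs []       = 0
    codeTs (t ∷ ts) = pair (codeT t) (codeTs ts)

  code : Formula → ℕ
  code (s ≐ t)   = pair 0 (pair (codeT s) (codeT t))
  code (Tr t)    = Ṫr (codeT t)
  code (¬' φ)    = ¬̇ (code φ)
  code (φ ∨' ψ)  = code φ ∨̇ code ψ
  code (φ ∧' ψ)  = code φ ∧̇ code ψ
  code (φ ⇒ ψ)   = code φ →̇ code ψ
  code (∀' v φ)  = ∀̇ v (code φ)
  code (∃' v φ)  = ∃̇ v (code φ)

  ⌜_⌝ : Formula → Term
  ⌜ φ ⌝ = num (code φ)

  mutual
    occT : ℕ → Term → Bool
    occT x (var y)     = x ≡ᵇ y
    occT x zer         = false
    occT x (suc' t)    = occT x t
    occT x (plus s t)  = occT x s ∨ occT x t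
    occT x (times s t) = occT x s ∨ occT x t
    occT x (app f ts)  = occTs x ts

    occTs : ∀ {n} → ℕ → Vec Term n → Bool
    occTs x []       = false
    occTs x (t ∷ ts) = occT x t ∨ occTs x ts

  ClosedT : Term → Set
  ClosedT t = ∀ x → occT x t ≡ false

  free : ℕ → Formula → Bool
  free x (s ≐ t)  = occT x s ∨ occT x t
  free x (Tr t)   = occT x t
  free x (¬' φ)   = free x φ
  free x (φ ∨' ψ) = free x φ ∨ free x ψ
  free x (φ ∧' ψ) = free x φ ∨ free x ψ
  free x (φ ⇒ ψ)  = free x φ ∨ free x ψ
  free x (∀' y φ) = not (y ≡ᵇ x) ∧ free x φ
  free x (∃' y φ) = not (y ≡ᵇ x) ∧ free x φ

  Sentence : Formula → Set
  Sentence φ = ∀ x → free x φ ≡ false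

  mutual
    substT : Term → ℕ → Term → Term
    substT (var y) x s     = if x ≡ᵇ y then s else var y
    substT zer x s         = zer
    substT (suc' t) x s    = suc' (substT t x s)
    substT (plus t u) x s  = plus (substT t x s) (substT u x s)
    substT (times t u) x s = times (substT t x s) (substT u x s)
    substT (app f ts) x s  = app f (substTs ts x s)

    substTs : ∀ {n} → Vec Term n → ℕ → Term → Vec Term n
    substTs [] x s       = []
    substTs (t ∷ ts) x s = substT t x s ∷ substTs ts x s

  _[_/_] : Formula → Term → ℕ → Formula
  (t ≐ u)  [ s / x ] = substT t x s ≐ substT u x s
  (Tr t)   [ s / x ] = Tr (substT t x s)
  (¬' φ)   [ s / x ] = ¬' (φ [ s / x ])
  (φ ∨' ψ) [ s / x ] = (φ [ s / x ]) ∨' (ψ [ s / x ])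
  (φ ∧' ψ) [ s / x ] = (φ [ s / x ]) ∧' (ψ [ s / x ])
  (φ ⇒ ψ)  [ s / x ] = (φ [ s / x ]) ⇒ (ψ [ s / x ])
  (∀' y φ) [ s / x ] = if y ≡ᵇ x then ∀' y φ else ∀' y (φ [ s / x ])
  (∃' y φ) [ s / x ] = if y ≡ᵇ x then ∃' y φ else ∃' y (φ [ s / x ])

  substitutable : ℕ → Term → Formula → Bool
  substitutable x s (t ≐ u)  = true
  substitutable x s (Tr t)   = true
  substitutable x s (¬' φ)   = substitutable x s φ
  substitutable x s (φ ∨' ψ) = substitutable x s φ ∧ substitutable x s ψ
  substitutable x s (φ ∧' ψ) = substitutable x s φ ∧ substitutable x s ψ
  substitutable x s (φ ⇒ ψ)  = substitutable x s φ ∧ substitutable x s ψ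
  substitutable x s (∀' y φ) =
    not (free x (∀' y φ)) ∨ (not (occT y s) ∧ substitutable x s φ)
  substitutable x s (∃' y φ) =
    not (free x (∃' y φ)) ∨ (not (occT y s) ∧ substitutable x s φ)

  mutual
    val : (ℕ → ℕ) → Term → ℕ
    val e (var x)     = e x
    val e zer         = 0
    val e (suc' t)    = suc (val e t)
    val e (plus s t)  = val e s + val e t
    val e (times s t) = val e s * val e t
    val e (app f ts)  = interp f (vals e ts)

    vals : ∀ {n} → (ℕ → ℕ) → Vec Term n → Vec ℕ n
    vals e []       = []
    vals e (t ∷ ts) = val e t ∷ vals e ts

  _° : Term → ℕ
  t ° = val (λ _ → 0) t

  -- propositional tautologies (prime formulas: atomic, Tr, quantified)
  evalB : (Formula → Bool) → Formula → Bool
  evalB v (¬' φ)   = not (evalB v φ)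
  evalB v (φ ∨' ψ) = evalB v φ ∨ evalB v ψ
  evalB v (φ ∧' ψ) = evalB v φ ∧ evalB v ψ
  evalB v (φ ⇒ ψ)  = not (evalB v φ) ∨ evalB v ψ
  evalB v φ        = v φ

  Tautology : Formula → Set
  Tautology φ = ∀ (v : Formula → Bool) → evalB v φ ≡ true

  data LogAx : Formula → Set where
    taut    : ∀ {φ} → Tautology φ → LogAx φ
    ∀-inst  : ∀ {x t φ} → substitutable x t φ ≡ true →
              LogAx (∀' x φ ⇒ (φ [ t / x ]))
    ∀-dist  : ∀ {x φ ψ} → LogAx (∀' x (φ ⇒ ψ) ⇒ (∀' x φ ⇒ ∀' x ψ))
    vac     : ∀ {x φ} → free x φ ≡ false → LogAx (φ ⇒ ∀' x φ)
    ∃-def₁  : ∀ {x φ} → LogAx (∃' x φ ⇒ ¬' (∀' x (¬' φ)))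
    ∃-def₂  : ∀ {x φ} → LogAx (¬' (∀' x (¬' φ)) ⇒ ∃' x φ)
    eq-refl : ∀ {t} → LogAx (t ≐ t)
    eq-subst : ∀ {x s t φ} → substitutable x s φ ≡ true →
               substitutable x t φ ≡ true →
               LogAx (s ≐ t ⇒ ((φ [ s / x ]) ⇒ (φ [ t / x ])))

  -- Derivations from a set of axioms Γ.  The Bool index says whether the
  -- omega-rule may be used (true) or not (false: ordinary provability).
  data Deriv (Γ : Formula → Set) : Bool → Formula → Set where
    ax    : ∀ {b φ} → Γ φ → Deriv Γ b φ
    log   : ∀ {b φ} → LogAx φ → Deriv Γ b φ
    mp    : ∀ {b φ ψ} → Deriv Γ b φ → Deriv Γ b (φ ⇒ ψ) → Deriv Γ b ψ
    gen   : ∀ {b x φ} → Deriv Γ b φ → Deriv Γ b (∀' x φ)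
    omega : ∀ {x φ} → ((n : ℕ) → Deriv Γ true (φ [ num n / x ])) →
            Deriv Γ true (∀' x φ)

  module Theory (defAx : Formula → Set) where
    -- defAx: the defining axioms for the extra function symbols.

    data PATAx : Formula → Set where
      Q1 : PATAx (¬' (suc' (var 0) ≐ zer))
      Q2 : PATAx (suc' (var 0) ≐ suc' (var 1) ⇒ var 0 ≐ var 1)
      Q3 : PATAx (plus (var 0) zer ≐ var 0)
      Q4 : PATAx (plus (var 0) (suc' (var 1)) ≐ suc' (plus (var 0) (var 1)))
      Q5 : PATAx (times (var 0) zer ≐ zer)
      Q6 : PATAx (times (var 0) (suc' (var 1)) ≐ plus (times (var 0) (var 1)) (var 0))
      ind : ∀ (φ : Formula) (x : ℕ) →
            PATAx (((φ [ zer / x ]) ∧' ∀' x (φ ⇒ (φ [ suc' (var x) / x ]))) ⇒ ∀' x φ)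
      defn : ∀ {φ} → defAx φ → PATAx φ

    PATTr : (ℕ → Set) → Formula → Set
    PATTr S φ = PATAx φ ⊎ Σ Formula (λ ψ → Sentence ψ × S (code ψ) × (φ ≡ Tr ⌜ ψ ⌝))

    _⊢ω_ : (ℕ → Set) → Formula → Set
    S ⊢ω φ = Deriv (PATTr S) true φ

    PrPAT : ℕ → Set
    PrPAT m = Σ Formula (λ χ → (code χ ≡ m) × Deriv PATAx false χ)

    Sent : ℕ → Set
    Sent m = Σ Formula (λ φ → Sentence φ × (code φ ≡ m))

    True₀ : ℕ → Set
    True₀ x = Σ Term λ s → Σ Term λ t → ClosedT s × ClosedT t ×
              ((x ≡ code (s ≐ t) × s ° ≡ t °) ⊎ (x ≡ code (¬' (s ≐ t)) × ¬ (s ° ≡ t °)))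

    -- ℕ ⊨ ξ(x, X), clause by clause
    data Ξ (X : ℕ → Set) : ℕ → Set where
      c-lit  : ∀ {x} → True₀ x → Ξ X x
      c-¬¬   : ∀ y → X y → Ξ X (¬̇ (¬̇ y))
      c-∨    : ∀ y z → X y ⊎ X z → Ξ X (y ∨̇ z)
      c-¬∨   : ∀ y z → X (¬̇ y) → X (¬̇ z) → Ξ X (¬̇ (y ∨̇ z))
      c-∧    : ∀ y z → X y → X z → Ξ X (y ∧̇ z)
      c-¬∧   : ∀ y z → X (¬̇ y) ⊎ X (¬̇ z) → Ξ X (¬̇ (y ∧̇ z))
      c-∀    : ∀ (α : Formula) v → (∀ z → X (code (α [ num z / v ]))) →
               Ξ X (∀̇ v (code α))
      c-¬∀   : ∀ (α : Formula) v → Σ ℕ (λ z → X (¬̇ (code (α [ num z / v ])))) →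
               Ξ X (¬̇ (∀̇ v (code α)))
      c-∃    : ∀ (α : Formula) v → Σ ℕ (λ z → X (code (α [ num z / v ]))) →
               Ξ X (∃̇ v (code α))
      c-¬∃   : ∀ (α : Formula) v → (∀ z → X (¬̇ (code (α [ num z / v ])))) →
               Ξ X (¬̇ (∃̇ v (code α)))
      c-Tr   : ∀ (t : Term) → ClosedT t → X (t °) → Ξ X (Ṫr (codeT t))
      c-¬Tr  : ∀ (t : Term) → ClosedT t → X (¬̇ (t °)) ⊎ ¬ Sent (t °) →
               Ξ X (¬̇ (Ṫr (codeT t)))

    Θ : (ℕ → Set) → ℕ → Set
    Θ S n = Σ ℕ λ y → Ξ S y × PrPAT (y →̇ n)

{-# OPTIONS --safe #-}
module Submission where

-- Only the inclusion Θ X ⊆ X is needed: X contains every formula that PAT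
-- derives from a member of Ξ X.  With the tautologies α → α, θ → (0 = 0 → θ)
-- and φ ∧ (φ → ψ) → ψ as those derivations, X contains Ξ X and every
-- PAT-theorem and is closed under modus ponens; via the Tr- and ∀-clauses of
-- Ξ it contains Tr⌜ψ⌝ for ψ ∈ X, and ∀x φ once it contains every numeral
-- instance φ(n̄/x).  These are the rules of ⊢ω, so induction on derivations
-- puts every derivable formula into X.  Generalisation is treated like the
-- ω-rule, which is why the induction carries a substitution of numerals.

open import Defs
open import Data.Bool using (true; false; not; _∧_; _∨_; if_then_else_; T)
open import Data.Bool.Properties using (∨-inverseˡ; ∨-zeroʳ)
open import Data.Empty using (⊥-elim)
open import Data.List using (List; []; _∷_; _++_; [_])
open import Data.Nat using (ℕ; zero; suc; _≡ᵇ_)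
open import Data.Nat.Properties using (≡ᵇ⇒≡; ≡⇒≡ᵇ)
open import Data.Product using (_×_; _,_; proj₂)
open import Data.Sum using (inj₁; inj₂)
open import Data.Vec using (Vec; []; _∷_)
open import Function using (_∘_)
open import Relation.Binary.PropositionalEquality
  using (_≡_; _≢_; refl; sym; trans; cong; cong₂; subst; module ≡-Reasoning)

≡ᵇ-true⇒≡ : ∀ {m n} → (m ≡ᵇ n) ≡ true → m ≡ n
≡ᵇ-true⇒≡ {m} {n} eq = ≡ᵇ⇒≡ m n (subst T (sym eq) _)

≡ᵇ-false⇒≢ : ∀ {m n} → (m ≡ᵇ n) ≡ false → m ≢ n
≡ᵇ-false⇒≢ {m} {n} eq m≡n = subst T eq (≡⇒≡ᵇ m n m≡n)

module _ (sig : Sig) where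
  open Syntax sig

  num-closed : ∀ n x → occT x (num n) ≡ false
  num-closed zero    x = refl
  num-closed (suc n) x = num-closed n x

  num° : ∀ n → num n ° ≡ n
  num° zero    = refl
  num° (suc n) = cong suc (num° n)

  substT-num : ∀ n x s → substT (num n) x s ≡ num n
  substT-num zero    x s = refl
  substT-num (suc n) x s = cong suc' (substT-num n x s)

  substitutable-num : ∀ x n φ → substitutable x (num n) φ ≡ true
  substitutable-num x n (s ≐ t)  = refl
  substitutable-num x n (Tr t)   = refl
  substitutable-num x n (¬' φ)   = substitutable-num x n φ
  substitutable-num x n (φ ∨' ψ) = cong₂ _∧_ (substitutable-num x n φ) (substitutable-num x n ψ)
  substitutable-num x n (φ ∧' ψ) = cong₂ _∧_ (substitutable-num x n φ) (substitutable-num x n ψ)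
  substitutable-num x n (φ ⇒ ψ)  = cong₂ _∧_ (substitutable-num x n φ) (substitutable-num x n ψ)
  substitutable-num x n (∀' y φ) rewrite num-closed n y | substitutable-num x n φ = ∨-zeroʳ _
  substitutable-num x n (∃' y φ) rewrite num-closed n y | substitutable-num x n φ = ∨-zeroʳ _

  ⇒-refl-tautology : ∀ φ → Tautology (φ ⇒ φ)
  ⇒-refl-tautology φ v = ∨-inverseˡ (evalB v φ)

  weakening-tautology : ∀ φ ψ → Tautology (φ ⇒ (ψ ⇒ φ))
  weakening-tautology φ ψ v with evalB v φ
  ... | true  = ∨-zeroʳ (not (evalB v ψ))
  ... | false = refl

  modus-ponens-tautology : ∀ φ ψ → Tautology ((φ ∧' (φ ⇒ ψ)) ⇒ ψ)
  modus-ponens-tautology φ ψ v with evalB v φ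
  ... | true  = ∨-inverseˡ (evalB v ψ)
  ... | false = refl

  module _ {x y : ℕ} (x≢y : x ≢ y) (a b : ℕ) where

    substT-var-comm : ∀ w → substT (substT (var w) x (num a)) y (num b)
                          ≡ substT (substT (var w) y (num b)) x (num a)
    substT-var-comm w with x ≡ᵇ w in x≡ᵇw | y ≡ᵇ w in y≡ᵇw
    ... | true  | true  =
      ⊥-elim (x≢y (trans (≡ᵇ-true⇒≡ {x} x≡ᵇw) (sym (≡ᵇ-true⇒≡ {y} y≡ᵇw))))
    ... | true  | false rewrite x≡ᵇw = substT-num a y (num b)
    ... | false | true  rewrite y≡ᵇw = sym (substT-num b x (num a))
    ... | false | false rewrite x≡ᵇw | y≡ᵇw = refl

    mutual
      substT-comm : ∀ t → substT (substT t x (num a)) y (num b)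
                        ≡ substT (substT t y (num b)) x (num a)
      substT-comm (var w)     = substT-var-comm w
      substT-comm zer         = refl
      substT-comm (suc' t)    = cong suc' (substT-comm t)
      substT-comm (plus s t)  = cong₂ plus (substT-comm s) (substT-comm t)
      substT-comm (times s t) = cong₂ times (substT-comm s) (substT-comm t)
      substT-comm (app f ts)  = cong (app f) (substTs-comm ts)

      substTs-comm : ∀ {m} (ts : Vec Term m) → substTs (substTs ts x (num a)) y (num b)
                                             ≡ substTs (substTs ts y (num b)) x (num a)
      substTs-comm []       = refl
      substTs-comm (t ∷ ts) = cong₂ _∷_ (substT-comm t) (substTs-comm ts)

    [/]-comm : ∀ φ → φ [ num a / x ] [ num b / y ] ≡ φ [ num b / y ] [ num a / x ]
    [/]-comm (s ≐ t)  = cong₂ _≐_ (substT-comm s) (substT-comm t)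
    [/]-comm (Tr t)   = cong Tr (substT-comm t)
    [/]-comm (¬' φ)   = cong ¬' ([/]-comm φ)
    [/]-comm (φ ∨' ψ) = cong₂ _∨'_ ([/]-comm φ) ([/]-comm ψ)
    [/]-comm (φ ∧' ψ) = cong₂ _∧'_ ([/]-comm φ) ([/]-comm ψ)
    [/]-comm (φ ⇒ ψ)  = cong₂ _⇒_ ([/]-comm φ) ([/]-comm ψ)
    [/]-comm (∀' w φ) with w ≡ᵇ x in w≡ᵇx | w ≡ᵇ y in w≡ᵇy
    ... | true  | true  =
      ⊥-elim (x≢y (trans (sym (≡ᵇ-true⇒≡ {w} w≡ᵇx)) (≡ᵇ-true⇒≡ {w} w≡ᵇy)))
    ... | true  | false rewrite w≡ᵇx | w≡ᵇy = refl
    ... | false | true  rewrite w≡ᵇx | w≡ᵇy = refl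
    ... | false | false rewrite w≡ᵇx | w≡ᵇy = cong (∀' w) ([/]-comm φ)
    [/]-comm (∃' w φ) with w ≡ᵇ x in w≡ᵇx | w ≡ᵇ y in w≡ᵇy
    ... | true  | true  =
      ⊥-elim (x≢y (trans (sym (≡ᵇ-true⇒≡ {w} w≡ᵇx)) (≡ᵇ-true⇒≡ {w} w≡ᵇy)))
    ... | true  | false rewrite w≡ᵇx | w≡ᵇy = refl
    ... | false | true  rewrite w≡ᵇx | w≡ᵇy = refl
    ... | false | false rewrite w≡ᵇx | w≡ᵇy = cong (∃' w) ([/]-comm φ)

  NumeralSubst : Set
  NumeralSubst = List (ℕ × ℕ)

  _⟦_⟧ : Formula → NumeralSubst → Formula
  φ ⟦ [] ⟧          = φ
  φ ⟦ (y , n) ∷ σ ⟧ = (φ [ num n / y ]) ⟦ σ ⟧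

  without : ℕ → NumeralSubst → NumeralSubst
  without x []            = []
  without x ((y , n) ∷ σ) = if x ≡ᵇ y then without x σ else (y , n) ∷ without x σ

  ⟦⟧-⇒ : ∀ φ ψ σ → (φ ⇒ ψ) ⟦ σ ⟧ ≡ ((φ ⟦ σ ⟧) ⇒ (ψ ⟦ σ ⟧))
  ⟦⟧-⇒ φ ψ []      = refl
  ⟦⟧-⇒ φ ψ (_ ∷ σ) = ⟦⟧-⇒ _ _ σ

  ⟦⟧-Tr-num : ∀ c σ → Tr (num c) ⟦ σ ⟧ ≡ Tr (num c)
  ⟦⟧-Tr-num c []            = refl
  ⟦⟧-Tr-num c ((y , n) ∷ σ) rewrite substT-num c y (num n) = ⟦⟧-Tr-num c σ

  ⟦⟧-∀ : ∀ x φ σ → ∀' x φ ⟦ σ ⟧ ≡ ∀' x (φ ⟦ without x σ ⟧)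
  ⟦⟧-∀ x φ []            = refl
  ⟦⟧-∀ x φ ((y , n) ∷ σ) with x ≡ᵇ y
  ... | true  = ⟦⟧-∀ x φ σ
  ... | false = ⟦⟧-∀ x _ σ

  ⟦⟧-snoc : ∀ φ σ x n → φ ⟦ σ ++ [ x , n ] ⟧ ≡ (φ ⟦ σ ⟧) [ num n / x ]
  ⟦⟧-snoc φ []      x n = refl
  ⟦⟧-snoc φ (_ ∷ σ) x n = ⟦⟧-snoc _ σ x n

  [/]-⟦without⟧-comm : ∀ x a φ σ →
    (φ [ num a / x ]) ⟦ without x σ ⟧ ≡ (φ ⟦ without x σ ⟧) [ num a / x ]
  [/]-⟦without⟧-comm x a φ []            = refl
  [/]-⟦without⟧-comm x a φ ((y , n) ∷ σ) with x ≡ᵇ y in x≡ᵇy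
  ... | true  = [/]-⟦without⟧-comm x a φ σ
  ... | false = begin
    (φ [ num a / x ] [ num n / y ]) ⟦ without x σ ⟧
      ≡⟨ cong (_⟦ without x σ ⟧) ([/]-comm (≡ᵇ-false⇒≢ {x} x≡ᵇy) a n φ) ⟩
    (φ [ num n / y ] [ num a / x ]) ⟦ without x σ ⟧
      ≡⟨ [/]-⟦without⟧-comm x a (φ [ num n / y ]) σ ⟩
    (φ [ num n / y ] ⟦ without x σ ⟧) [ num a / x ]
      ∎
    where open ≡-Reasoning

  module _ (defAx : Formula → Set) where
    open Theory defAx

    PAT⊢_ : Formula → Set
    PAT⊢ θ = Deriv PATAx false θ

    PAT⊢-[/]num : ∀ {θ} x n → PAT⊢ θ → PAT⊢ (θ [ num n / x ])
    PAT⊢-[/]num {θ} x n d = mp (gen d) (log (∀-inst {x = x} (substitutable-num x n θ)))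

    PAT⊢-⟦⟧ : ∀ {θ} σ → PAT⊢ θ → PAT⊢ (θ ⟦ σ ⟧)
    PAT⊢-⟦⟧ []            d = d
    PAT⊢-⟦⟧ ((y , n) ∷ σ) d = PAT⊢-⟦⟧ σ (PAT⊢-[/]num y n d)

    module _ (X : ℕ → Set) (Θ⊆X : ∀ n → Θ X n → X n) where

      PAT-consequence-∈ : ∀ α θ → Ξ X (code α) → PAT⊢ (α ⇒ θ) → X (code θ)
      PAT-consequence-∈ α θ ξ d = Θ⊆X (code θ) (code α , ξ , (α ⇒ θ) , refl , d)

      Ξ⊆X : ∀ φ → Ξ X (code φ) → X (code φ)
      Ξ⊆X φ ξ = PAT-consequence-∈ φ φ ξ (log (taut (⇒-refl-tautology φ)))

      PAT⊢⇒∈ : ∀ {θ} → PAT⊢ θ → X (code θ)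
      PAT⊢⇒∈ {θ} d = PAT-consequence-∈ (zer ≐ zer) θ (c-lit true-0≐0)
                        (mp d (log (taut (weakening-tautology θ (zer ≐ zer)))))
        where
        true-0≐0 : True₀ (code (zer ≐ zer))
        true-0≐0 = zer , zer , (λ _ → refl) , (λ _ → refl) , inj₁ (refl , refl)

      ∈-mp : ∀ φ ψ → X (code φ) → X (code (φ ⇒ ψ)) → X (code ψ)
      ∈-mp φ ψ φ∈X φ⇒ψ∈X =
        PAT-consequence-∈ (φ ∧' (φ ⇒ ψ)) ψ (c-∧ _ _ φ∈X φ⇒ψ∈X)
          (log (taut (modus-ponens-tautology φ ψ)))

      ∈-Tr : ∀ c → X c → X (code (Tr (num c)))
      ∈-Tr c c∈X =
        Ξ⊆X (Tr (num c)) (c-Tr (num c) (num-closed c) (subst X (sym (num° c)) c∈X))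

      ∈-∀ : ∀ x φ → (∀ n → X (code (φ [ num n / x ]))) → X (code (∀' x φ))
      ∈-∀ x φ instances∈X = Ξ⊆X (∀' x φ) (c-∀ φ x instances∈X)

      ∈-∀-⟦⟧ : ∀ x φ σ → (∀ n → X (code ((φ ⟦ without x σ ⟧) [ num n / x ])))
             → X (code (∀' x φ ⟦ σ ⟧))
      ∈-∀-⟦⟧ x φ σ instances∈X =
        subst (X ∘ code) (sym (⟦⟧-∀ x φ σ)) (∈-∀ x (φ ⟦ without x σ ⟧) instances∈X)

      ⊢ω⇒∈-⟦⟧ : ∀ {φ} → X ⊢ω φ → ∀ σ → X (code (φ ⟦ σ ⟧))
      ⊢ω⇒∈-⟦⟧ (ax (inj₁ pat)) σ = PAT⊢⇒∈ (PAT⊢-⟦⟧ σ (ax pat))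
      ⊢ω⇒∈-⟦⟧ (ax (inj₂ (ψ , _ , ψ∈X , refl))) σ =
        subst (X ∘ code) (sym (⟦⟧-Tr-num (code ψ) σ)) (∈-Tr (code ψ) ψ∈X)
      ⊢ω⇒∈-⟦⟧ (log l) σ = PAT⊢⇒∈ (PAT⊢-⟦⟧ σ (log l))
      ⊢ω⇒∈-⟦⟧ (mp {φ = φ} {ψ = ψ} d e) σ =
        ∈-mp (φ ⟦ σ ⟧) (ψ ⟦ σ ⟧) (⊢ω⇒∈-⟦⟧ d σ)
          (subst (X ∘ code) (⟦⟧-⇒ φ ψ σ) (⊢ω⇒∈-⟦⟧ e σ))
      ⊢ω⇒∈-⟦⟧ (gen {x = x} {φ = φ} d) σ = ∈-∀-⟦⟧ x φ σ λ n →
        subst (X ∘ code) (⟦⟧-snoc φ (without x σ) x n)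
          (⊢ω⇒∈-⟦⟧ d (without x σ ++ [ x , n ]))
      ⊢ω⇒∈-⟦⟧ (omega {x = x} {φ = φ} d) σ = ∈-∀-⟦⟧ x φ σ λ n →
        subst (X ∘ code) ([/]-⟦without⟧-comm x n φ σ) (⊢ω⇒∈-⟦⟧ (d n) (without x σ))

lemma7p5 : (sig : Sig) → let open Syntax sig in
    (defAx : Formula → Set) → let open Theory defAx in
    (X : ℕ → Set) →
    (∀ n → (X n → Θ X n) × (Θ X n → X n)) →
    (φ : Formula) → Sentence φ → X ⊢ω φ → X (code φ)
lemma7p5 sig defAx X X≡ΘX φ _ d = ⊢ω⇒∈-⟦⟧ sig defAx X (proj₂ ∘ X≡ΘX) d []
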